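{- Let $M=(X,R_E,R_\Box,v)$ be a finite relational evidence and knowability model, and let $\mathcal{M}_M=(X,\mathcal{E},\oplus,I,v)$ be the evidence interaction model constructed as follows: enumerate the upsets of $(X,R_\Box)$ as $E_1,\dots,E_n$ with $E_n=X$; let $\mathcal{E}=\{e_1,\dots,e_n\}$ with $e_i\leq e_j$ iff $E_i\subseteq E_j$; let $\oplus$ be the greatest lower bound in $(\mathcal{E},\leq)$; and let $I_{e_i}(x)=E_i\cap R_E(x)$. Then for all $\varphi\in\mathcal{L}_{E,K,\Box}$ and $x\in X$: $M,x\models\varphi$ if and only if $(\mathcal{M}_M,x,e_n)\models\varphi$.
   Context: $\mathcal{L}_{E,K,\Box}$ is generated by $\phi ::= p \mid \neg\phi \mid \phi\wedge\psi \mid E\phi \mid K\phi \mid \Box\phi$. A finite relational evidence and knowability model is $(X,R_E,R_\Box,v)$ with $X$ finite nonempty, $R_E$ reflexive, $R_\Box$ reflexive and transitive, $v:\textsc{prop}\to 2^X$; writing $R(x)=\{y : xRy\}$ and $\|\phi\|_M=\{x : M,x\models\phi\}$, relational truth is: $p$ via $v$, Booleans as usual, $M,x\models E\phi$ iff $R_E(x)\subseteq\|\phi\|_M$, $M,x\models K\phi$ iff $\|\phi\|_M=X$, $M,x\models\Box\phi$ iff $R_\Box(x)\subseteq\|\phi\|_M$. An upset of $(X,R_\Box)$ is $S\subseteq X$ closed under $R_\Box$-successors. In an evidence interaction model $(X,\mathcal{E},\oplus,I,v)$, let $U_e=\{x : x\in I_e(x)\}$ and $[\![\phi]\!]^e=\{y\in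 U_e : (y,e)\models\phi\}$; formulas are evaluated at $(x,e)$ with $x\in U_e$ by: $p$ via $v$; Booleans as usual; $(x,e)\models E\phi$ iff $I_e(x)\subseteq[\![\phi]\!]^e$; $(x,e)\models K\phi$ iff $U_e\subseteq[\![\phi]\!]^e$; $(x,e)\models\Box\phi$ iff there is $e'\in\mathcal{E}$ with $x\in U_{e\oplus e'}\subseteq[\![\phi]\!]^e$. -}

module Defs where

open import Data.Nat using (ℕ; suc)
open import Data.Fin using (Fin)
open import Data.Fin.Subset using (Subset; _∈_; _⊆_; ⊤)
open import Data.Fin.Subset.Properties using (∈⊤)
open import Data.Bool using (Bool; true)
open import Data.Product using (Σ; ∃; _×_; _,_; proj₁)
open import Relation.Nullary using (¬_)
open import Relation.Binary.PropositionalEquality using (_≡_)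

data Form : Set where
  var  : ℕ → Form
  ~_   : Form → Form
  _∧_  : Form → Form → Form
  E    : Form → Form
  K    : Form → Form
  □    : Form → Form

-- Finite relational evidence and knowability model on X = Fin m.
-- Relations are Boolean-valued (x R y  iff  R x y ≡ true).
record RelModel (m : ℕ) : Set₁ where
  field
    RE     : Fin m → Fin m → Bool
    RB     : Fin m → Fin m → Bool
    val    : ℕ → Fin m → Set
    RE-refl  : ∀ x → RE x x ≡ true
    RB-refl  : ∀ x → RB x x ≡ true
    RB-trans : ∀ x y z → RB x y ≡ true → RB y z ≡ true → RB x z ≡ true

_,_⊨_ : ∀ {m} → RelModel m → Fin m → Form → Set
M , x ⊨ var p   = RelModel.val M p x
M , x ⊨ (~ φ)   = ¬ (M , x ⊨ φ)
M , x ⊨ (φ ∧ ψ) = (M , x ⊨ φ) × (M , x ⊨ ψ)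
M , x ⊨ E φ     = ∀ y → RelModel.RE M x y ≡ true → M , y ⊨ φ
M , x ⊨ K φ     = ∀ y → M , y ⊨ φ
M , x ⊨ □ φ     = ∀ y → RelModel.RB M x y ≡ true → M , y ⊨ φ

-- Evidence interaction model (X, ℰ, ⊕, I, v) with X = Fin m;
-- I e x is a subset of X given as a membership predicate  I e x y  (y ∈ I_e(x)).
record EIModel (m : ℕ) : Set₁ where
  field
    Ev   : Set
    _⊕_  : Ev → Ev → Ev
    I    : Ev → Fin m → Fin m → Set
    val  : ℕ → Fin m → Set

U : ∀ {m} (N : EIModel m) → EIModel.Ev N → Fin m → Set
U N e x = EIModel.I N e x x

-- truth at (x , e); the paper only evaluates at x ∈ U_e, and all quantifiers
-- range over [[φ]]^e = { y ∈ U_e | (y,e) ⊨ φ }.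
_,_,_⊨ᵉ_ : ∀ {m} (N : EIModel m) → Fin m → EIModel.Ev N → Form → Set
N , x , e ⊨ᵉ var p   = EIModel.val N p x
N , x , e ⊨ᵉ (~ φ)   = ¬ (N , x , e ⊨ᵉ φ)
N , x , e ⊨ᵉ (φ ∧ ψ) = (N , x , e ⊨ᵉ φ) × (N , x , e ⊨ᵉ ψ)
N , x , e ⊨ᵉ E φ     = ∀ y → EIModel.I N e x y → U N e y × (N , y , e ⊨ᵉ φ)
N , x , e ⊨ᵉ K φ     = ∀ y → U N e y → N , y , e ⊨ᵉ φ
N , x , e ⊨ᵉ □ φ     = Σ (EIModel.Ev N) λ e′ →
                         U N (EIModel._⊕_ N e e′) x ×
                         (∀ y → U N (EIModel._⊕_ N e e′) y → U N e y × (N , y , e ⊨ᵉ φ))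

IsUpset : ∀ {m} → RelModel m → Subset m → Set
IsUpset M S = ∀ x y → RelModel.RB M x y ≡ true → x ∈ S → y ∈ S

-- the evidence set ℰ: the upsets of (X, R_□) (the enumeration E_1..E_n is
-- just an indexing of this set); ordered by  e ≤ e'  iff  E ⊆ E'
Upset : ∀ {m} → RelModel m → Set
Upset M = Σ (Subset _) (IsUpset M)

LeU : ∀ {m} (M : RelModel m) → Upset M → Upset M → Set
LeU M a b = proj₁ a ⊆ proj₁ b

topUpset : ∀ {m} (M : RelModel m) → Upset M
topUpset M = ⊤ , λ _ _ _ _ → ∈⊤

IsGLB : ∀ {m} (M : RelModel m) → (Upset M → Upset M → Upset M) → Set
IsGLB M _⊕_ = ∀ a b →
  LeU M (a ⊕ b) a × LeU M (a ⊕ b) b ×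
  (∀ c → LeU M c a → LeU M c b → LeU M c (a ⊕ b))

EIMof : ∀ {m} (M : RelModel m) → (Upset M → Upset M → Upset M) → EIModel m
EIMof M _⊕_ = record
  { Ev  = Upset M
  ; _⊕_ = _⊕_
  ; I   = λ e x y → (y ∈ proj₁ e) × (RelModel.RE M x y ≡ true)
  ; val = RelModel.val M
  }

module Submission where

-- The evidence pieces of 𝓜_M are the upsets of
-- (X, R_□); the worlds x ∈ U_e are exactly those of the upset e (since R_E
-- is reflexive), and the top evidence X makes every world admissible.
--
-- The only modality needing thought is □.  Relationally, □ is the interior
-- operator of the upset topology: R_□(x) ⊆ P iff some upset containing x
-- lies inside P, because R_□(x) is itself an upset (R_□ is reflexive and
-- transitive) and every upset containing x contains R_□(x).  On the other
-- side, at the top evidence X, combining with e′ yields X ⊓ e′, which has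
-- the same members as e′; so (x, X) ⊨ □φ says exactly that some upset
-- containing x is contained in the truth set of φ.

open import Defs
open import Data.Nat using (ℕ; suc)
open import Data.Fin using (Fin)
open import Data.Bool using (Bool; true)
open import Data.Product using (Σ; _×_; _,_; proj₁; proj₂)
open import Data.Vec using (tabulate)
open import Data.Vec.Properties using (lookup∘tabulate; []=⇒lookup; lookup⇒[]=)
open import Data.Fin.Subset using (Subset; _∈_)
open import Data.Fin.Subset.Properties using (∈⊤)
open import Function.Bundles using (_⇔_; mk⇔; Equivalence)
open import Relation.Binary.PropositionalEquality using (_≡_; trans; sym)

open Equivalence using (to; from)

toSubset : ∀ {n} → (Fin n → Bool) → Subset n
toSubset f = tabulate f

∈toSubset⇔ : ∀ {n} (f : Fin n → Bool) (y : Fin n) → (y ∈ toSubset f) ⇔ (f y ≡ true)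
∈toSubset⇔ f y = mk⇔
  (λ y∈ → trans (sym (lookup∘tabulate f y)) ([]=⇒lookup y∈))
  (λ fy → lookup⇒[]= y (toSubset f) (trans (lookup∘tabulate f y) fy))

module RelationalBox {m : ℕ} (M : RelModel m) where
  open RelModel M

  successors : Fin m → Upset M
  successors x = toSubset (RB x) , closed
    where
      closed : IsUpset M (toSubset (RB x))
      closed y z yz y∈ = from (∈toSubset⇔ (RB x) z)
        (RB-trans x y z (to (∈toSubset⇔ (RB x) y) y∈) yz)

  self∈successors : ∀ x → x ∈ proj₁ (successors x)
  self∈successors x = from (∈toSubset⇔ (RB x) x) (RB-refl x)

  □⇔upset : ∀ x (P : Fin m → Set) →
    (∀ y → RB x y ≡ true → P y) ⇔
    Σ (Upset M) (λ S → x ∈ proj₁ S × (∀ y → y ∈ proj₁ S → P y))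
  □⇔upset x P = mk⇔
    (λ h → successors x , self∈successors x ,
           λ y y∈ → h y (to (∈toSubset⇔ (RB x) y) y∈))
    (λ { ((S , up) , x∈S , h) y xy → h y (up x y xy x∈S) })

module TopEvidence {m : ℕ} (M : RelModel m)
    (_⊕_ : Upset M → Upset M → Upset M) (glb : IsGLB M _⊕_) where
  open RelModel M
  N : EIModel m
  N = EIMof M _⊕_

  T : Upset M
  T = topUpset M

  top⊕⇔ : ∀ a y → (y ∈ proj₁ (T ⊕ a)) ⇔ (y ∈ proj₁ a)
  top⊕⇔ a y = mk⇔ (proj₁ (proj₂ (glb T a)))
                  (proj₂ (proj₂ (glb T a)) a (λ _ → ∈⊤) (λ y∈ → y∈))

  U-top : ∀ y → U N T y
  U-top y = ∈⊤ , RE-refl y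

  U-top⊕⇔ : ∀ a y → U N (T ⊕ a) y ⇔ (y ∈ proj₁ a)
  U-top⊕⇔ a y = mk⇔ (λ u → to (top⊕⇔ a y) (proj₁ u))
                    (λ y∈ → from (top⊕⇔ a y) y∈ , RE-refl y)

  □-top⇔ : ∀ x φ → (N , x , T ⊨ᵉ □ φ) ⇔
    Σ (Upset M) (λ S → x ∈ proj₁ S × (∀ y → y ∈ proj₁ S → N , y , T ⊨ᵉ φ))
  □-top⇔ x φ = mk⇔
    (λ { (a , x∈ , h) → a , to (U-top⊕⇔ a x) x∈ ,
                         λ y y∈ → proj₂ (h y (from (U-top⊕⇔ a y) y∈)) })
    (λ { (a , x∈ , h) → a , from (U-top⊕⇔ a x) x∈ ,
                         λ y u → U-top y , h y (to (U-top⊕⇔ a y) u) })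

module TruthLemma {m : ℕ} (M : RelModel m)
    (_⊕_ : Upset M → Upset M → Upset M) (glb : IsGLB M _⊕_) where
  open RelationalBox M
  open TopEvidence M _⊕_ glb

  truth⇔ : ∀ φ x → (M , x ⊨ φ) ⇔ (N , x , T ⊨ᵉ φ)
  truth⇔ (var p) x = mk⇔ (λ h → h) (λ h → h)
  truth⇔ (~ φ) x = mk⇔ (λ h g → h (from (truth⇔ φ x) g))
                       (λ h g → h (to (truth⇔ φ x) g))
  truth⇔ (φ ∧ ψ) x = mk⇔ (λ (a , b) → to (truth⇔ φ x) a , to (truth⇔ ψ x) b)
                         (λ (a , b) → from (truth⇔ φ x) a , from (truth⇔ ψ x) b)
  truth⇔ (E φ) x = mk⇔ (λ h y (_ , xy) → U-top y , to (truth⇔ φ y) (h y xy))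
                       (λ h y xy → from (truth⇔ φ y) (proj₂ (h y (∈⊤ , xy))))
  truth⇔ (K φ) x = mk⇔ (λ h y _ → to (truth⇔ φ y) (h y))
                       (λ h y → from (truth⇔ φ y) (h y (U-top y)))
  truth⇔ (□ φ) x = mk⇔
    (λ h → from (□-top⇔ x φ) (lift to (to (□⇔upset x (M ,_⊨ φ)) h)))
    (λ h → from (□⇔upset x (M ,_⊨ φ)) (lift from (to (□-top⇔ x φ) h)))
    where
      lift : ∀ {P Q : Fin m → Set} → (∀ {y} → (M , y ⊨ φ) ⇔ (N , y , T ⊨ᵉ φ) → P y → Q y) →
             Σ (Upset M) (λ S → x ∈ proj₁ S × (∀ y → y ∈ proj₁ S → P y)) →
             Σ (Upset M) (λ S → x ∈ proj₁ S × (∀ y → y ∈ proj₁ S → Q y))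
      lift dir (S , x∈ , h) = S , x∈ , λ y y∈ → dir (truth⇔ φ y) (h y y∈)

lemma5 : (k : ℕ) (M : RelModel (suc k))
         (_⊕_ : Upset M → Upset M → Upset M) → IsGLB M _⊕_ →
         (φ : Form) (x : Fin (suc k)) →
         ((M , x ⊨ φ) → (EIMof M _⊕_ , x , topUpset M ⊨ᵉ φ)) ×
         ((EIMof M _⊕_ , x , topUpset M ⊨ᵉ φ) → (M , x ⊨ φ))
lemma5 k M _⊕_ glb φ x = to truth , from truth
  where
    truth : (M , x ⊨ φ) ⇔ (EIMof M _⊕_ , x , topUpset M ⊨ᵉ φ)
    truth = TruthLemma.truth⇔ M _⊕_ glb φ x
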